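{- The first-order formula $\forall y(Rxy\vee Ryx)$ is not $\mathsf{MLSR}$-definable: there is no $\mathsf{MLSR}$-formula $\varphi$ such that for every model $\mathcal{M}=(W,R,V)$ and every $s\in W$, $\mathcal{M},s\models\varphi$ iff $\mathcal{M}\models\forall y(Rsy\vee Rys)$.
   Context: $\mathsf{MLSR}$-formulas: $\varphi ::= p \mid \neg\varphi \mid (\varphi\vee\varphi)\mid \Diamond\varphi \mid \langle-\varphi\rangle\varphi$. Models are $\mathcal{M}=(W,R,V)$ with $R\subseteq W\times W$, $V$ a valuation; $\mathcal{M}-\{t\}$ is the submodel with domain $W\setminus\{t\}$. Truth is standard for letters, Booleans and $\Diamond$, and $\mathcal{M},s\models\langle-\alpha\rangle\beta$ iff there is $t\neq s$ with $\mathcal{M},t\models\alpha$ and $\mathcal{M}-\{t\},s\models\beta$. -}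

module Defs where

open import Data.Nat using (ℕ)
open import Data.Product using (Σ; _×_; _,_; ∃)
open import Data.Sum using (_⊎_)
open import Relation.Nullary using (¬_)
open import Relation.Binary.PropositionalEquality using (_≡_; _≢_; sym)

data Form : Set where
  var   : ℕ → Form
  ¬'_   : Form → Form
  _∨'_  : Form → Form → Form
  ◇_    : Form → Form
  ⟨-_⟩_ : Form → Form → Form

record Model : Set₁ where
  field
    W : Set
    R : W → W → Set
    V : ℕ → W → Set
open Model public

_∖_ : (M : Model) → W M → Model
W (M ∖ t) = Σ (W M) (λ w → w ≢ t)
R (M ∖ t) (u , _) (v , _) = R M u v
V (M ∖ t) p (u , _) = V M p u

_,_⊨_ : (M : Model) → W M → Form → Set
M , s ⊨ var p = V M p s
M , s ⊨ (¬' φ) = ¬ (M , s ⊨ φ)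
M , s ⊨ (φ ∨' ψ) = (M , s ⊨ φ) ⊎ (M , s ⊨ ψ)
M , s ⊨ (◇ φ) = Σ (W M) (λ t → R M s t × (M , t ⊨ φ))
M , s ⊨ (⟨- α ⟩ β) =
  Σ (W M) (λ t → Σ (t ≢ s) (λ t≢s →
    (M , t ⊨ α) × ((M ∖ t) , (s , (λ e → t≢s (sym e))) ⊨ β)))

Connected : (M : Model) → W M → Set
Connected M s = (y : W M) → R M s y ⊎ R M y s

-- Call a model featureless when no letter is true anywhere and every point
-- has successors outside any given finite set. Featureless models cannot be
-- told apart by MLSR-formulas: a ◇-witness, or a point deleted by ⟨-α⟩, can
-- be matched by a fresh successor, and deleting one point keeps a model
-- featureless. The complete graph on ℕ is connected at 0, while two disjoint
-- complete graphs (on the even and on the odd numbers) are not; both are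
-- featureless, so no formula defines connectedness.
module Submission where

open import Defs
open import Data.Empty using (⊥; ⊥-elim)
open import Data.List using (List; []; _∷_; map)
open import Data.List.Extrema.Nat using (max; xs≤max)
open import Data.List.Membership.Propositional using (_∉_)
open import Data.List.Membership.Propositional.Properties using (∈-map⁺)
open import Data.List.Relation.Unary.All using (lookup)
open import Data.List.Relation.Unary.Any using (here; there)
open import Data.Nat using (ℕ; suc; _+_; _*_; _<_)
open import Data.Nat.DivMod using (_%_; [m+kn]%n≡m%n)
open import Data.Nat.Properties using (<⇒≱; ≤-refl; ≤-trans; m≤m*n; m≤n+m)
open import Data.Product using (Σ; ∃; _×_; _,_; proj₁; proj₂)
open import Data.Sum using (inj₁; inj₂)
open import Data.Unit using (⊤; tt)
open import Relation.Nullary using (¬_)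
open import Relation.Binary.PropositionalEquality using (_≡_; _≢_; sym)

record Featureless (M : Model) : Set where
  field
    no-letters      : ∀ p x → ¬ V M p x
    fresh-successor : ∀ x (L : List (W M)) → ∃ λ y → R M x y × y ∉ L
open Featureless

featureless-∖ : ∀ {M} (t : W M) → Featureless M → Featureless (M ∖ t)
featureless-∖ t F .no-letters p (x , _) = F .no-letters p x
featureless-∖ t F .fresh-successor (x , _) L
  with F .fresh-successor x (t ∷ map proj₁ L)
... | y , xRy , y∉ = (y , λ y≡t → y∉ (here y≡t)) , xRy , λ y∈L → y∉ (there (∈-map⁺ proj₁ y∈L))

featureless-⊨ : ∀ {M N} → Featureless M → Featureless N →
                ∀ φ (s : W M) (u : W N) → M , s ⊨ φ → N , u ⊨ φ
featureless-⊨ FM FN (var p) s u s⊨p = ⊥-elim (FM .no-letters p s s⊨p)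
featureless-⊨ FM FN (¬' φ) s u s⊭φ u⊨φ = s⊭φ (featureless-⊨ FN FM φ u s u⊨φ)
featureless-⊨ FM FN (φ ∨' ψ) s u (inj₁ s⊨φ) = inj₁ (featureless-⊨ FM FN φ s u s⊨φ)
featureless-⊨ FM FN (φ ∨' ψ) s u (inj₂ s⊨ψ) = inj₂ (featureless-⊨ FM FN ψ s u s⊨ψ)
featureless-⊨ FM FN (◇ φ) s u (t , _ , t⊨φ) with FN .fresh-successor u []
... | y , uRy , _ = y , uRy , featureless-⊨ FM FN φ t y t⊨φ
featureless-⊨ FM FN (⟨- α ⟩ β) s u (t , _ , t⊨α , s⊨β) with FN .fresh-successor u (u ∷ [])
... | y , _ , y∉[u] =
  y , y≢u , featureless-⊨ FM FN α t y t⊨α ,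
  featureless-⊨ (featureless-∖ t FM) (featureless-∖ y FN) β _ _ s⊨β
  where
  y≢u : y ≢ u
  y≢u y≡u = y∉[u] (here y≡u)

max<⇒∉ : ∀ {y} (L : List ℕ) → max 0 L < y → y ∉ L
max<⇒∉ L max<y y∈L = <⇒≱ max<y (lookup (xs≤max 0 L) y∈L)

completeℕ : Model
completeℕ .W = ℕ
completeℕ .R _ _ = ⊤
completeℕ .V _ _ = ⊥

featureless-completeℕ : Featureless completeℕ
featureless-completeℕ .no-letters p x ()
featureless-completeℕ .fresh-successor x L = suc (max 0 L) , tt , max<⇒∉ L ≤-refl

sameParityℕ : Model
sameParityℕ .W = ℕ
sameParityℕ .R x y = x % 2 ≡ y % 2
sameParityℕ .V _ _ = ⊥

featureless-sameParityℕ : Featureless sameParityℕ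
featureless-sameParityℕ .no-letters p x ()
featureless-sameParityℕ .fresh-successor x L =
  x + m * 2 , sym ([m+kn]%n≡m%n x m 2) , max<⇒∉ L (≤-trans (m≤m*n m 2) (m≤n+m (m * 2) x))
  where
  m : ℕ
  m = suc (max 0 L)

completeℕ-connected : Connected completeℕ 0
completeℕ-connected _ = inj₁ tt

sameParityℕ-disconnected : ¬ Connected sameParityℕ 0
sameParityℕ-disconnected connected with connected 1
... | inj₁ ()
... | inj₂ ()

mainTheorem3 : ¬ Σ Form (λ φ → (M : Model) → (s : W M) →
    ((M , s ⊨ φ) → Connected M s) × (Connected M s → (M , s ⊨ φ)))
mainTheorem3 (φ , defines) = sameParityℕ-disconnected (proj₁ (defines sameParityℕ 0) sameParityℕ⊨φ)
  where
  completeℕ⊨φ : completeℕ , 0 ⊨ φ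
  completeℕ⊨φ = proj₂ (defines completeℕ 0) completeℕ-connected

  sameParityℕ⊨φ : sameParityℕ , 0 ⊨ φ
  sameParityℕ⊨φ = featureless-⊨ featureless-completeℕ featureless-sameParityℕ φ 0 0 completeℕ⊨φ
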